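{- Let $A,B$ be types and $F:(A\to B^\nu)\to(A\to B^\nu)$ be finitary, and define $k_0=\lambda a.\,\mathsf{step}^\infty$ and $k_{n+1}=F\,k_n$. For all $n,m:\mathbb{N}$ with $n\le m$, $k_n\sqsubseteq k_m$; equivalently, for all $a:A$ and $b:B$, $k_n\,a\downarrow b$ implies $k_m\,a\downarrow b$.
   Context: Work in an intensional constructive dependent type theory with inductive and coinductive types. For a type $B$, $B^\nu$ is the coinductive type with constructors $\mathsf{return}:B\to B^\nu$ and $\mathsf{step}:B^\nu\to B^\nu$; $\mathsf{step}^\infty=\mathsf{step}\,\mathsf{step}^\infty$. Convergence $x\downarrow b$ is inductive: $\mathsf{return}\,b\downarrow b$; $x\downarrow b\Rightarrow\mathsf{step}\,x\downarrow b$. The convergence order $x\sqsubseteq y$ is coinductive with rules: if $x\downarrow b$ and $y\downarrow b$ then $x\sqsubseteq y$; if $x\sqsubseteq y$ then $\mathsf{step}\,x\sqsubseteq\mathsf{step}\,y$; if $x\sqsubseteq y$ then $\mathsf{step}\,x\sqsubseteq y$; for functions $f_1\sqsubseteq f_2$ iff $\forall a.\,f_1\,a\sqsubseteq f_2\,a$. $F$ is finitary if for every $f:A\to B^\nu$, $a:A$, $b:B$ with $F\,f\,a\downarrow b$, there exist finitely many $a_1,\dots,a_n:A$ and $b_1,\dots,b_n:B$ with $f\,a_i\downarrow b_i$ for all $i$ such that for every $g:A\to B^\nu$, if $g\,a_i\downarrow b_i$ for all $i$ then $F\,g\,a\downarrow b$. -}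

module Defs where

open import Data.Nat using (ℕ; zero; suc)
open import Data.Maybe using (Maybe; just; nothing)
open import Data.Sum using (_⊎_; inj₁; inj₂)
open import Data.Product using (Σ; _×_; _,_; proj₁; proj₂)
open import Data.List using (List)
open import Data.List.Relation.Unary.All using (All)
open import Relation.Binary.PropositionalEquality using (_≡_; refl)

record Delay (B : Set) : Set where
  field
    seq  : ℕ → Maybe B
    mono : ∀ n b → seq n ≡ just b → seq (suc n) ≡ just b
open Delay public

module _ {B : Set} where

  return : B → Delay B
  seq  (return b) _ = just b
  mono (return b) _ _ e = e

  step : Delay B → Delay B
  seq  (step x) zero    = nothing
  seq  (step x) (suc n) = seq x n
  mono (step x) zero    b ()
  mono (step x) (suc n) b e = mono x n b e

  step∞ : Delay B
  seq  step∞ _ = nothing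
  mono step∞ _ _ ()

  tl : Delay B → Delay B
  seq  (tl x) n = seq x (suc n)
  mono (tl x) n = mono x (suc n)

  out : Delay B → B ⊎ Delay B
  out x with seq x zero
  ... | just b  = inj₁ b
  ... | nothing = inj₂ (tl x)

  infix 4 _↓_
  data _↓_ (x : Delay B) (b : B) : Set where
    now   : out x ≡ inj₁ b → x ↓ b
    later : ∀ {x'} → out x ≡ inj₂ x' → x' ↓ b → x ↓ b

  -- the convergence order (coinductive), presented as the greatest fixed
  -- point of its three rules via its finite approximants:
  -- x ⊑ y  iff  for every depth k, the rules can be unfolded k times.
  data Approx : ℕ → Delay B → Delay B → Set where
    stop : ∀ {x y} → Approx zero x y
    conv : ∀ {k x y b} → x ↓ b → y ↓ b → Approx (suc k) x y
    both : ∀ {k x y x' y'} → out x ≡ inj₂ x' → out y ≡ inj₂ y' →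
           Approx k x' y' → Approx (suc k) x y
    left : ∀ {k x y x'} → out x ≡ inj₂ x' →
           Approx k x' y → Approx (suc k) x y

  infix 4 _⊑_
  _⊑_ : Delay B → Delay B → Set
  x ⊑ y = ∀ k → Approx k x y

infix 4 _⊑ᶠ_
_⊑ᶠ_ : {A B : Set} → (A → Delay B) → (A → Delay B) → Set
f₁ ⊑ᶠ f₂ = ∀ a → f₁ a ⊑ f₂ a

Finitary : {A B : Set} → ((A → Delay B) → (A → Delay B)) → Set
Finitary {A} {B} F =
  ∀ (f : A → Delay B) (a : A) (b : B) → F f a ↓ b →
  Σ (List (A × B)) λ abs →
    All (λ p → f (proj₁ p) ↓ proj₂ p) abs ×
    (∀ (g : A → Delay B) → All (λ p → g (proj₁ p) ↓ proj₂ p) abs → F g a ↓ b)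

kseq : {A B : Set} → ((A → Delay B) → (A → Delay B)) → ℕ → (A → Delay B)
kseq F zero    = λ _ → step∞
kseq F (suc n) = F (kseq F n)

-- A finitary F preserves inclusion of convergence graphs, because the finitely
-- many values that F f a ↓ b depends on are also values of g.  Since k₀
-- converges nowhere, induction on n ≤ m then shows that every value of kₙ is
-- a value of kₘ, and a pointwise inclusion of values is an instance of ⊑.
module Submission where

open import Defs
open import Data.Nat using (ℕ; _≤_; zero; suc; z≤n; s≤s)
open import Data.Product using (_×_; _,_; proj₁; proj₂)
open import Data.Sum using (inj₁; inj₂)
open import Data.Maybe using (just; nothing)
import Data.List.Relation.Unary.All as All
open import Relation.Nullary using (¬_; contradiction)
open import Relation.Binary.PropositionalEquality using (_≡_; refl; sym; trans)

module _ {B : Set} where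

  out-inj₁⇒seq₀ : (x : Delay B) {b : B} → out x ≡ inj₁ b → seq x zero ≡ just b
  out-inj₁⇒seq₀ x e with seq x zero
  out-inj₁⇒seq₀ x refl | just _ = refl

  out-inj₂⇒seq-suc : (x : Delay B) {x' : Delay B} → out x ≡ inj₂ x' →
                     ∀ n → seq x' n ≡ seq x (suc n)
  out-inj₂⇒seq-suc x e n with seq x zero
  out-inj₂⇒seq-suc x refl n | nothing = refl

  silent⇒¬↓ : (x : Delay B) {b : B} → (∀ n → seq x n ≡ nothing) → ¬ (x ↓ b)
  silent⇒¬↓ x silent (now e) with trans (sym (silent zero)) (out-inj₁⇒seq₀ x e)
  ... | ()
  silent⇒¬↓ x silent (later {x'} e x'↓b) =
    silent⇒¬↓ x' (λ n → trans (out-inj₂⇒seq-suc x e n) (silent (suc n))) x'↓b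

  step∞-¬↓ : {b : B} → ¬ (step∞ ↓ b)
  step∞-¬↓ = silent⇒¬↓ step∞ (λ _ → refl)

  -- Peel x with the `left` rule until it returns, then close with `conv`.
  ↓⊆⇒⊑ : (x y : Delay B) → (∀ b → x ↓ b → y ↓ b) → x ⊑ y
  ↓⊆⇒⊑ x y x↓⊆y↓ zero = stop
  ↓⊆⇒⊑ x y x↓⊆y↓ (suc k) with out x in eq
  ... | inj₁ b  = conv (now eq) (x↓⊆y↓ b (now eq))
  ... | inj₂ x' = left eq (↓⊆⇒⊑ x' y (λ b x'↓b → x↓⊆y↓ b (later eq x'↓b)) k)

infix 4 _↓⊆_
_↓⊆_ : {A B : Set} → (A → Delay B) → (A → Delay B) → Set
f ↓⊆ g = ∀ a b → f a ↓ b → g a ↓ b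

module _ {A B : Set} {F : (A → Delay B) → (A → Delay B)} (fin : Finitary F) where

  finitary-mono-↓⊆ : {f g : A → Delay B} → f ↓⊆ g → F f ↓⊆ F g
  finitary-mono-↓⊆ f↓⊆g a b Ffa↓b with fin _ a b Ffa↓b
  ... | _ , f↓ , use = use _ (All.map (λ {p} → f↓⊆g (proj₁ p) (proj₂ p)) f↓)

  kseq-mono-↓⊆ : ∀ {n m} → n ≤ m → kseq F n ↓⊆ kseq F m
  kseq-mono-↓⊆ z≤n       a b k₀a↓b = contradiction k₀a↓b step∞-¬↓
  kseq-mono-↓⊆ (s≤s n≤m) = finitary-mono-↓⊆ (kseq-mono-↓⊆ n≤m)

lemma6p16 : {A B : Set} (F : (A → Delay B) → (A → Delay B)) → Finitary F →
    ∀ (n m : ℕ) → n ≤ m →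
      (kseq F n ⊑ᶠ kseq F m) ×
      (∀ (a : A) (b : B) → kseq F n a ↓ b → kseq F m a ↓ b)
lemma6p16 F fin n m n≤m = (λ a → ↓⊆⇒⊑ _ _ (kₙ↓⊆kₘ a)) , kₙ↓⊆kₘ
  where
    kₙ↓⊆kₘ : kseq F n ↓⊆ kseq F m
    kₙ↓⊆kₘ = kseq-mono-↓⊆ fin n≤m
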